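{- Let $(p_\lambda(\mathbf y))_\lambda$ be the full sequence of symmetric functions of binomial type associated with the quasi-genus $(G_\lambda)_\lambda$. Then for every complex number $x$ and every partition $\lambda$, $$p_\lambda(x,y_1,y_2,\dots)=E^xp_\lambda(\mathbf y)=\sum_{\alpha}\binom\lambda\alpha x^{|\alpha|}G_\alpha\,p_{\lambda-\alpha}(\mathbf y),$$ the sum over vectors $\alpha$ of nonnegative integers with $\alpha\le\lambda$ componentwise.
   Context: A quasi-genus is a family of complex numbers $(G_\lambda)$ indexed by partitions with $G_{(0)}=1$, $G_{(1)}\neq0$. The sequence associated with it is $p_\lambda(\mathbf y)=\sum_{f:S\to\{1,2,\dots\}}\prod_{k\ge1}G_{\mathrm{type}(\pi|_{f^{ -1}(k)})}\prod_{s\in S}y_{f(s)}$, where $S$ is a finite set with a set partition $\pi$ of type $\lambda$ (type = integer partition of block sizes; $\pi|_T$ = nonempty intersections of blocks with $T$); it is assumed full, i.e. each $p_\lambda$ is homogeneous whose largest monomial $m_\mu$ (in reverse lexicographic order) with nonzero coefficient is $m_\lambda$. $E^x p(y_1,y_2,\dots)=p(x,y_1,y_2,\dots)$. For vectors $\alpha$, $G_\alpha,p_\alpha$ mean $G_\mu,p_\mu$ with $\mu$ the decreasing rearrangement of $\alpha$; $|\alpha|=\sum\alpha_i$; $\binom\lambda\alpha=\lambda!/(\alpha!(\lambda-\alpha)!)$ with $\alpha!=\prod\alpha_i!$. -}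

module Defs where

open import Level using (Level)
open import Algebra.Bundles using (CommutativeRing)
open import Data.Nat as ℕ using (ℕ; zero; suc; _≤?_; _∸_)
open import Data.Nat.Combinatorics using (_C_)
open import Data.Bool using (if_then_else_)
open import Data.Fin as Fin using (Fin)
open import Data.List using (List; []; _∷_; [_]; map; filter; foldr; concatMap; concat;
  length; zipWith; upTo; allFin)
open import Data.Nat.ListAction using (sum; product)
import Data.List.Properties as LP
open import Data.List.Relation.Unary.All using (All)
open import Data.List.Relation.Unary.Linked using (Linked)
open import Data.Vec as Vec using (Vec; lookup)
open import Data.Empty using (⊥)
open import Data.Product using (_×_)
open import Data.Sum using (_⊎_)
open import Relation.Nullary using (¬_; does)
open import Relation.Binary.PropositionalEquality using (_≡_)

insertDesc : ℕ → List ℕ → List ℕ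
insertDesc a [] = a ∷ []
insertDesc a (b ∷ bs) = if does (b ≤? a) then a ∷ b ∷ bs else b ∷ insertDesc a bs

sortDesc : List ℕ → List ℕ
sortDesc = foldr insertDesc []

-- the partition μ associated with a vector α: drop zeros, sort decreasingly
norm : List ℕ → List ℕ
norm l = sortDesc (filter (λ k → 1 ≤? k) l)

IsPartition : List ℕ → Set
IsPartition la = Linked ℕ._≥_ la × All (λ k → 1 ℕ.≤ k) la

allVecs : (n m : ℕ) → List (List (Fin n))
allVecs n zero = [] ∷ []
allVecs n (suc m) = concatMap (λ i → map (i ∷_) (allVecs n m)) (allFin n)

-- S is the disjoint union of blocks of sizes la_i (the set partition π of
-- type la).  A map f : S → {1..n} is encoded as a list whose i-th entry is
-- the list of values of f on block i.  This enumerates every map once.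
allAssign : (n : ℕ) → List ℕ → List (List (List (Fin n)))
allAssign n [] = [] ∷ []
allAssign n (b ∷ bs) = concatMap (λ v → map (v ∷_) (allAssign n bs)) (allVecs n b)

count : {n : ℕ} → Fin n → List (Fin n) → ℕ
count k l = length (filter (λ j → j Fin.≟ k) l)

fiberType : {n : ℕ} → List (List (Fin n)) → Fin n → List ℕ
fiberType f k = norm (map (count k) f)

fiberSizes : {n : ℕ} → List (List (Fin n)) → List ℕ
fiberSizes {n} f = map (λ k → sum (map (count k) f)) (allFin n)

lexGT : List ℕ → List ℕ → Set
lexGT [] [] = ⊥
lexGT (a ∷ as) [] = (0 ℕ.< a) ⊎ ((a ≡ 0) × lexGT as [])
lexGT [] (b ∷ bs) = (b ℕ.< 0) ⊎ ((0 ≡ b) × lexGT [] bs)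
lexGT (a ∷ as) (b ∷ bs) = (b ℕ.< a) ⊎ ((a ≡ b) × lexGT as bs)

boxVecs : List ℕ → List (List ℕ)
boxVecs [] = [] ∷ []
boxVecs (l ∷ ls) = concatMap (λ a → map (a ∷_) (boxVecs ls)) (upTo (suc l))

binomVec : List ℕ → List ℕ → ℕ
binomVec la α = product (zipWith _C_ la α)

module _ {c ℓ : Level} (R : CommutativeRing c ℓ) where
  open CommutativeRing R

  sumR : List Carrier → Carrier
  sumR = foldr _+_ 0#

  prodR : List Carrier → Carrier
  prodR = foldr _*_ 1#

  natR : ℕ → Carrier
  natR zero = 0#
  natR (suc k) = 1# + natR k

  powR : Carrier → ℕ → Carrier
  powR x zero = 1#
  powR x (suc k) = x * powR x k

  -- (G_λ) quasi-genus: G_(0) = 1, G_(1) ≠ 0.  G is indexed by partitions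
  -- (as decreasing lists); the empty partition is the partition (0).
  QuasiGenus : (List ℕ → Carrier) → Set ℓ
  QuasiGenus G = (G [] ≈ 1#) × (¬ (G (1 ∷ []) ≈ 0#))

  -- ∏_{k} G_{type(π|f⁻¹(k))}  (factors k > n are G_(0) = 1)
  weight : (List ℕ → Carrier) → {n : ℕ} → List (List (Fin n)) → Carrier
  weight G {n} f = prodR (map (λ k → G (fiberType f k)) (allFin n))

  monomial : {n : ℕ} → Vec Carrier n → List (List (Fin n)) → Carrier
  monomial y f = prodR (map (lookup y) (concat f))

  -- p_λ evaluated at (y_1,…,y_n,0,0,…)
  pEval : (List ℕ → Carrier) → List ℕ → {n : ℕ} → Vec Carrier n → Carrier
  pEval G la {n} y = sumR (map (λ f → weight G f * monomial y f) (allAssign n la))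

  coeff : (List ℕ → Carrier) → List ℕ → List ℕ → Carrier
  coeff G la μ =
    sumR (map (weight G)
      (filter (λ f → LP.≡-dec ℕ._≟_ (fiberSizes f) μ) (allAssign (length μ) la)))

  -- fullness: the largest monomial m_μ (reverse lex) with nonzero
  -- coefficient in p_λ is m_λ  (homogeneity is automatic)
  Full : (List ℕ → Carrier) → Set ℓ
  Full G = ∀ la → IsPartition la →
    (¬ (coeff G la la ≈ 0#)) ×
    (∀ μ → IsPartition μ → sum μ ≡ sum la → lexGT μ la → coeff G la μ ≈ 0#)

  rhs : (List ℕ → Carrier) → List ℕ → Carrier → {n : ℕ} → Vec Carrier n → Carrier
  rhs G la x y = sumR (map (λ α →
      natR (binomVec la α) * powR x (sum α) * G (norm α)
        * pEval G (norm (zipWith _∸_ la α)) y)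
    (boxVecs la))

{-# OPTIONS --safe #-}
module Submission where

open import Defs
open import Level using (Level)
open import Algebra.Bundles using (CommutativeRing)
open import Data.Nat using (ℕ)
open import Data.List using (List)
open import Data.Vec using (Vec; _∷_)

import Algebra.Properties.CommutativeSemigroup as CommSemigroupProperties
import Algebra.Properties.Semiring.Exp as SemiringExp
import Algebra.Properties.Semiring.Mult as SemiringMult
open import Data.Bool using (if_then_else_)
open import Data.Fin as Fin using (Fin)
open import Data.List using ([]; _∷_; map; filter; concatMap; concat; _++_; zipWith; upTo;
  applyUpTo; allFin)
import Data.List.Properties as ListP
open import Data.List.Relation.Binary.Permutation.Propositional as ↭ using (_↭_; ↭⇒↭ₛ′)
import Data.List.Relation.Binary.Permutation.Propositional.Properties as ↭P
import Data.List.Relation.Binary.Permutation.Setoid.Properties as ↭ₛP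
open import Data.List.Relation.Binary.Pointwise using (Pointwise-≡⇒≡)
import Data.List.Sort.InsertionSort.Base as InsertionSort
import Data.List.Sort.InsertionSort.Properties as InsertionSortₚ
open import Data.Nat as ℕ using (zero; suc; _∸_)
import Data.Nat.Properties as ℕP
open import Data.Nat.Combinatorics using (_C_; nCk+nC[k+1]≡[n+1]C[k+1]; k>n⇒nCk≡0)
open import Data.Nat.ListAction using (sum)
import Data.Vec as Vec
open import Function using (_∘_; id)
open import Relation.Binary.Bundles using (DecTotalOrder)
import Relation.Binary.Construct.Flip.EqAndOrd as Flip
open import Relation.Binary.PropositionalEquality as ≡ using (_≡_)
open import Relation.Nullary using (yes; no; does)
import Relation.Unary as U

-- Split a map f : S → {x, y₁, …, yₙ} into A = f⁻¹(x) and the restriction of f to S ∖ A.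
-- If A meets the blocks of π in α = (αᵢ) elements, the fibre over x contributes x^|α| G_α,
-- the restriction ranges over the maps counted by p_{λ-α}(y), and there are ∏ binom(λᵢ, αᵢ)
-- choices of A.  Blockwise this count is Pascal's rule, applied to words over Fin (n + 1)
-- split by their number of letters x.  Finally p_{λ-α} as an unsorted list of block sizes
-- agrees with p of its partition, because the weights are invariant under permuting blocks
-- and under adding empty ones.

private
  variable
    a b : Level
    A : Set a
    B : Set b

module _ {a ℓ₁ ℓ₂} (O : DecTotalOrder a ℓ₁ ℓ₂) where
  open DecTotalOrder O using (module Eq)
  open InsertionSort O using (sort)
  open InsertionSortₚ O using (insert-congʳ; insert-swap-cong)
  open import Data.List.Relation.Binary.Equality.Setoid Eq.setoid using (_≋_; ≋-refl; ≋-trans)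

  sort-cong-↭ : ∀ {xs ys} → xs ↭ ys → sort xs ≋ sort ys
  sort-cong-↭ ↭.refl         = ≋-refl
  sort-cong-↭ (↭.prep x p)   = insert-congʳ x (sort-cong-↭ p)
  sort-cong-↭ (↭.swap x y p) = insert-swap-cong Eq.refl Eq.refl (sort-cong-↭ p)
  sort-cong-↭ (↭.trans p q)  = ≋-trans (sort-cong-↭ p) (sort-cong-↭ q)

≥-decTotalOrder : DecTotalOrder _ _ _
≥-decTotalOrder = Flip.decTotalOrder ℕP.≤-decTotalOrder

open InsertionSort ≥-decTotalOrder using (insert; sort)

insertDesc≡insert : ∀ x xs → insertDesc x xs ≡ insert x xs
insertDesc≡insert x []       = ≡.refl
insertDesc≡insert x (y ∷ xs) =
  ≡.cong (λ t → if does (y ℕ.≤? x) then x ∷ y ∷ xs else y ∷ t) (insertDesc≡insert x xs)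

sortDesc≡sort : ∀ xs → sortDesc xs ≡ sort xs
sortDesc≡sort []       = ≡.refl
sortDesc≡sort (x ∷ xs) =
  ≡.trans (≡.cong (insertDesc x) (sortDesc≡sort xs)) (insertDesc≡insert x (sort xs))

positive? : U.Decidable (1 ℕ.≤_)
positive? k = 1 ℕ.≤? k

norm-↭ : ∀ l → norm l ↭ filter positive? l
norm-↭ l = ≡.subst (_↭ filter positive? l) (≡.sym (sortDesc≡sort (filter positive? l)))
  (InsertionSortₚ.sort-↭ ≥-decTotalOrder (filter positive? l))

norm-cong-↭ : ∀ {l l′} → l ↭ l′ → norm l ≡ norm l′
norm-cong-↭ {l} {l′} p = begin
  sortDesc (filter positive? l)  ≡⟨ sortDesc≡sort (filter positive? l) ⟩
  sort (filter positive? l)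
    ≡⟨ Pointwise-≡⇒≡ (sort-cong-↭ ≥-decTotalOrder (↭P.filter-↭ positive? p)) ⟩
  sort (filter positive? l′)     ≡⟨ sortDesc≡sort (filter positive? l′) ⟨
  sortDesc (filter positive? l′) ∎
  where open ≡.≡-Reasoning

-- In a word over Fin (suc n) the letter zero stands for the new variable x.
count₀ : ∀ {n} → List (Fin (suc n)) → ℕ
count₀ = count Fin.zero

strip₀ : ∀ {n} → List (Fin (suc n)) → List (Fin n)
strip₀ []               = []
strip₀ (Fin.zero  ∷ v) = strip₀ v
strip₀ (Fin.suc i ∷ v) = i ∷ strip₀ v

count-suc : ∀ {n} (k : Fin n) v → count (Fin.suc k) v ≡ count k (strip₀ v)
count-suc k []               = ≡.refl
count-suc k (Fin.zero  ∷ v) = count-suc k v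
count-suc k (Fin.suc i ∷ v) with i Fin.≟ k
... | yes _ = ≡.cong suc (count-suc k v)
... | no  _ = count-suc k v

fiberType-suc : ∀ {n} (f : List (List (Fin (suc n)))) k →
  fiberType f (Fin.suc k) ≡ fiberType (map strip₀ f) k
fiberType-suc f k = ≡.cong norm (≡.trans (ListP.map-cong (count-suc k) f) (ListP.map-∘ f))

map-allFin-suc : ∀ {n} (h : Fin (suc n) → A) →
  map h (allFin (suc n)) ≡ h Fin.zero ∷ map (h ∘ Fin.suc) (allFin n)
map-allFin-suc h = ≡.cong (h Fin.zero ∷_)
  (≡.trans (ListP.map-tabulate Fin.suc h) (≡.sym (ListP.map-tabulate id (h ∘ Fin.suc))))

module BigOperators {c ℓ} (R : CommutativeRing c ℓ) where
  open CommutativeRing R hiding (zero)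
  open CommSemigroupProperties +-commutativeSemigroup using () renaming
    (interchange to +-interchange; x∙yz≈y∙xz to x+[y+z]≈y+[x+z])
  open SemiringMult semiring using (_×_; ×-homo-+; ×1-homo-*)
  open SemiringExp semiring using (_^_; ^-homo-*)
  open ↭ₛP setoid using (foldr-commMonoid)
  open import Relation.Binary.Reasoning.Setoid setoid

  Σ : List A → (A → Carrier) → Carrier
  Σ xs f = sumR R (map f xs)

  Π : List A → (A → Carrier) → Carrier
  Π xs f = prodR R (map f xs)

  Σ-cong : ∀ (xs : List A) {f g : A → Carrier} → (∀ x → f x ≈ g x) → Σ xs f ≈ Σ xs g
  Σ-cong []       f≈g = refl
  Σ-cong (x ∷ xs) f≈g = +-cong (f≈g x) (Σ-cong xs f≈g)

  Σ-++ : ∀ (xs ys : List A) f → Σ (xs ++ ys) f ≈ Σ xs f + Σ ys f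
  Σ-++ []       ys f = sym (+-identityˡ _)
  Σ-++ (x ∷ xs) ys f = trans (+-congˡ (Σ-++ xs ys f)) (sym (+-assoc _ _ _))

  Σ-map : ∀ (g : A → B) xs f → Σ (map g xs) f ≡ Σ xs (f ∘ g)
  Σ-map g xs f = ≡.cong (sumR R) (≡.sym (ListP.map-∘ xs))

  Σ-concatMap : ∀ (g : A → List B) xs f → Σ (concatMap g xs) f ≈ Σ xs (λ x → Σ (g x) f)
  Σ-concatMap g []       f = refl
  Σ-concatMap g (x ∷ xs) f = trans (Σ-++ (g x) (concatMap g xs) f) (+-congˡ (Σ-concatMap g xs f))

  Σ-concatMap-∷ : ∀ (xs : List A) (yss : List (List A)) f →
    Σ (concatMap (λ x → map (x ∷_) yss) xs) f ≈ Σ xs (λ x → Σ yss (λ ys → f (x ∷ ys)))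
  Σ-concatMap-∷ xs yss f =
    trans (Σ-concatMap _ xs f) (Σ-cong xs (λ x → reflexive (Σ-map (x ∷_) yss f)))

  Σ-zero : ∀ (xs : List A) → Σ xs (λ _ → 0#) ≈ 0#
  Σ-zero []       = refl
  Σ-zero (x ∷ xs) = trans (+-identityˡ _) (Σ-zero xs)

  Σ-+ : ∀ (xs : List A) (f g : A → Carrier) → Σ xs f + Σ xs g ≈ Σ xs (λ x → f x + g x)
  Σ-+ []       f g = +-identityˡ _
  Σ-+ (x ∷ xs) f g = trans (+-interchange _ _ _ _) (+-congˡ (Σ-+ xs f g))

  Σ-comm : ∀ (xs : List A) (ys : List B) (f : A → B → Carrier) →
    Σ xs (λ x → Σ ys (f x)) ≈ Σ ys (λ y → Σ xs (λ x → f x y))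
  Σ-comm []       ys f = sym (Σ-zero ys)
  Σ-comm (x ∷ xs) ys f = trans (+-congˡ (Σ-comm xs ys f)) (Σ-+ ys (f x) _)

  *-distribˡ-Σ : ∀ k (xs : List A) f → k * Σ xs f ≈ Σ xs (λ x → k * f x)
  *-distribˡ-Σ k []       f = zeroʳ k
  *-distribˡ-Σ k (x ∷ xs) f = trans (distribˡ k _ _) (+-congˡ (*-distribˡ-Σ k xs f))

  Π-++ : ∀ (xs ys : List A) f → Π (xs ++ ys) f ≈ Π xs f * Π ys f
  Π-++ []       ys f = sym (*-identityˡ _)
  Π-++ (x ∷ xs) ys f = trans (*-congˡ (Π-++ xs ys f)) (sym (*-assoc _ _ _))

  Π-concat : ∀ (xss : List (List A)) f → Π (concat xss) f ≈ Π xss (λ xs → Π xs f)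
  Π-concat []         f = refl
  Π-concat (xs ∷ xss) f = trans (Π-++ xs (concat xss) f) (*-congˡ (Π-concat xss f))

  Π-cong-↭ : ∀ {xs ys : List A} f → xs ↭ ys → Π xs f ≈ Π ys f
  Π-cong-↭ f p = foldr-commMonoid *-isCommutativeMonoid (↭⇒↭ₛ′ isEquivalence (↭P.map⁺ f p))

  natR≡×1 : ∀ k → natR R k ≡ k × 1#
  natR≡×1 zero    = ≡.refl
  natR≡×1 (suc k) = ≡.cong (1# +_) (natR≡×1 k)

  natR-1*x+0≈x : ∀ x → natR R 1 * x + 0# ≈ x
  natR-1*x+0≈x x = trans (+-identityʳ _) (trans (*-congʳ (+-identityʳ 1#)) (*-identityˡ x))

  natR-+ : ∀ m n → natR R (m ℕ.+ n) ≈ natR R m + natR R n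
  natR-+ m n rewrite natR≡×1 m | natR≡×1 n | natR≡×1 (m ℕ.+ n) = ×-homo-+ 1# m n

  natR-* : ∀ m n → natR R (m ℕ.* n) ≈ natR R m * natR R n
  natR-* m n rewrite natR≡×1 m | natR≡×1 n | natR≡×1 (m ℕ.* n) = ×1-homo-* m n

  powR≡^ : ∀ x k → powR R x k ≡ x ^ k
  powR≡^ x zero    = ≡.refl
  powR≡^ x (suc k) = ≡.cong (x *_) (powR≡^ x k)

  powR-+ : ∀ x m n → powR R x (m ℕ.+ n) ≈ powR R x m * powR R x n
  powR-+ x m n rewrite powR≡^ x m | powR≡^ x n | powR≡^ x (m ℕ.+ n) = ^-homo-* x m n

  Σ< : ℕ → (ℕ → Carrier) → Carrier
  Σ< zero    g = 0#
  Σ< (suc m) g = g 0 + Σ< m (g ∘ suc)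

  Σ-applyUpTo : ∀ (f : ℕ → A) m h → Σ (applyUpTo f m) h ≡ Σ< m (h ∘ f)
  Σ-applyUpTo f zero    h = ≡.refl
  Σ-applyUpTo f (suc m) h = ≡.cong (h (f 0) +_) (Σ-applyUpTo (f ∘ suc) m h)

  Σ<-cong : ∀ m {g h : ℕ → Carrier} → (∀ i → i ℕ.< m → g i ≈ h i) → Σ< m g ≈ Σ< m h
  Σ<-cong zero    g≈h = refl
  Σ<-cong (suc m) g≈h =
    +-cong (g≈h 0 (ℕ.s≤s ℕ.z≤n)) (Σ<-cong m (λ i i<m → g≈h (suc i) (ℕ.s≤s i<m)))

  Σ<-last : ∀ m g → Σ< (suc m) g ≈ Σ< m g + g m
  Σ<-last zero    g = +-comm _ _
  Σ<-last (suc m) g = trans (+-congˡ (Σ<-last m (g ∘ suc))) (sym (+-assoc _ _ _))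

  Σ<-+ : ∀ m (g h : ℕ → Carrier) → Σ< m g + Σ< m h ≈ Σ< m (λ i → g i + h i)
  Σ<-+ zero    g h = +-identityˡ _
  Σ<-+ (suc m) g h = trans (+-interchange _ _ _ _) (+-congˡ (Σ<-+ m (g ∘ suc) (h ∘ suc)))

  Σbinom : ℕ → (ℕ → ℕ → Carrier) → Carrier
  Σbinom b F = Σ< (suc b) (λ a → natR R (b C a) * F a (b ∸ a))

  Σbinom-cong : ∀ b {F F′ : ℕ → ℕ → Carrier} → (∀ a m → F a m ≈ F′ a m) →
    Σbinom b F ≈ Σbinom b F′
  Σbinom-cong b F≈F′ = Σ<-cong (suc b) (λ a _ → *-congˡ {natR R (b C a)} (F≈F′ a (b ∸ a)))

  Σbinom-suc : ∀ b F →
    Σbinom (suc b) F ≈ Σbinom b (λ a → F (suc a)) + Σbinom b (λ a m → F a (suc m))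
  Σbinom-suc b F = begin
    Σbinom (suc b) F
      ≈⟨ +-congˡ (Σ<-cong (suc b) (λ a _ → pascal a)) ⟩
    T₀ + Σ< (suc b) (λ a → U a + V a)
      ≈⟨ +-congˡ (sym (Σ<-+ (suc b) U V)) ⟩
    T₀ + (Σbinom b (λ a → F (suc a)) + Σ< (suc b) V)
      ≈⟨ +-congˡ (+-congˡ V-shift) ⟩
    T₀ + (Σbinom b (λ a → F (suc a)) + Σ< b V′)
      ≈⟨ x+[y+z]≈y+[x+z] _ _ _ ⟩
    Σbinom b (λ a → F (suc a)) + Σbinom b (λ a m → F a (suc m)) ∎
    where
    T₀ : Carrier
    T₀ = natR R (b C 0) * F 0 (suc b)
    U V V′ : ℕ → Carrier
    U a  = natR R (b C a) * F (suc a) (b ∸ a)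
    V a  = natR R (b C suc a) * F (suc a) (b ∸ a)
    V′ a = natR R (b C suc a) * F (suc a) (suc (b ∸ suc a))
    pascal : ∀ a → natR R (suc b C suc a) * F (suc a) (b ∸ a) ≈ U a + V a
    pascal a = begin
      natR R (suc b C suc a) * F (suc a) (b ∸ a)
        ≡⟨ ≡.cong (λ k → natR R k * F (suc a) (b ∸ a)) (nCk+nC[k+1]≡[n+1]C[k+1] b a) ⟨
      natR R (b C a ℕ.+ b C suc a) * F (suc a) (b ∸ a)
        ≈⟨ *-congʳ (natR-+ (b C a) (b C suc a)) ⟩
      (natR R (b C a) + natR R (b C suc a)) * F (suc a) (b ∸ a)
        ≈⟨ distribʳ _ _ _ ⟩
      U a + V a ∎
    C[b,1+b]≡0 : b C suc b ≡ 0
    C[b,1+b]≡0 = k>n⇒nCk≡0 (ℕP.n<1+n b)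
    V-shift : Σ< (suc b) V ≈ Σ< b V′
    V-shift = begin
      Σ< (suc b) V  ≈⟨ Σ<-last b V ⟩
      Σ< b V + V b  ≈⟨ +-congˡ (trans (*-congʳ (reflexive (≡.cong (natR R) C[b,1+b]≡0))) (zeroˡ _)) ⟩
      Σ< b V + 0#   ≈⟨ +-identityʳ _ ⟩
      Σ< b V        ≈⟨ Σ<-cong b (λ a a<b →
                         *-congˡ (reflexive (≡.cong (F (suc a)) (ℕP.+-∸-assoc 1 a<b)))) ⟩
      Σ< b V′       ∎

module Assignments {c ℓ} (R : CommutativeRing c ℓ) where
  open CommutativeRing R hiding (zero)
  open BigOperators R
  open CommSemigroupProperties *-commutativeSemigroup using () renaming
    (interchange to *-interchange; x∙yz≈y∙xz to x*[y*z]≈y*[x*z])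
  open import Relation.Binary.Reasoning.Setoid setoid

  Σ-allAssign-∷ : ∀ n b bs (F : List (List (Fin n)) → Carrier) →
    Σ (allAssign n (b ∷ bs)) F ≈ Σ (allVecs n b) (λ v → Σ (allAssign n bs) (λ g → F (v ∷ g)))
  Σ-allAssign-∷ n b bs F = Σ-concatMap-∷ (allVecs n b) (allAssign n bs) F

  Σ-allVecs-suc : ∀ n b (h : List (Fin n) → Carrier) →
    Σ (allVecs n (suc b)) h ≈ Σ (allFin n) (λ i → Σ (allVecs n b) (λ w → h (i ∷ w)))
  Σ-allVecs-suc n b h = Σ-concatMap-∷ (allFin n) (allVecs n b) h

  -- The first letter is either x or a letter over y: the two terms of Σbinom-suc.
  Σ-allVecs-split : ∀ n b (H : ℕ → List (Fin n) → Carrier) →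
    Σ (allVecs (suc n) b) (λ v → H (count₀ v) (strip₀ v)) ≈
    Σbinom b (λ a m → Σ (allVecs n m) (H a))
  Σ-allVecs-split n zero    H = sym (natR-1*x+0≈x _)
  Σ-allVecs-split n (suc b) H = begin
    Σ (allVecs (suc n) (suc b)) (λ v → H (count₀ v) (strip₀ v))
      ≈⟨ Σ-allVecs-suc (suc n) b _ ⟩
    Σ (allFin (suc n)) startingWith
      ≡⟨ ≡.cong (sumR R) (map-allFin-suc startingWith) ⟩
    Σ (allVecs (suc n) b) (λ w → H (suc (count₀ w)) (strip₀ w))
      + Σ (allFin n) (λ i → Σ (allVecs (suc n) b) (λ w → H (count₀ w) (i ∷ strip₀ w)))
      ≈⟨ +-cong (Σ-allVecs-split n b (H ∘ suc))
           (trans (Σ-comm (allFin n) (allVecs (suc n) b) _)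
                  (Σ-allVecs-split n b (λ a w → Σ (allFin n) (λ i → H a (i ∷ w))))) ⟩
    Σbinom b (λ a m → Σ (allVecs n m) (H (suc a)))
      + Σbinom b (λ a m → Σ (allVecs n m) (λ w → Σ (allFin n) (λ i → H a (i ∷ w))))
      ≈⟨ +-congˡ (Σbinom-cong b (λ a m →
           sym (trans (Σ-allVecs-suc n m (H a)) (Σ-comm (allFin n) (allVecs n m) _)))) ⟩
    Σbinom b (λ a m → Σ (allVecs n m) (H (suc a)))
      + Σbinom b (λ a m → Σ (allVecs n (suc m)) (H a))
      ≈⟨ Σbinom-suc b (λ a m → Σ (allVecs n m) (H a)) ⟨
    Σbinom (suc b) (λ a m → Σ (allVecs n m) (H a)) ∎
    where
    startingWith : Fin (suc n) → Carrier
    startingWith i = Σ (allVecs (suc n) b) (λ w → H (count₀ (i ∷ w)) (strip₀ (i ∷ w)))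

  Σ-allAssign-split : ∀ n la (K : List ℕ → List (List (Fin n)) → Carrier) →
    Σ (allAssign (suc n) la) (λ f → K (map count₀ f) (map strip₀ f)) ≈
    Σ (boxVecs la) (λ α → natR R (binomVec la α) * Σ (allAssign n (zipWith _∸_ la α)) (K α))
  Σ-allAssign-split n []       K = sym (natR-1*x+0≈x _)
  Σ-allAssign-split n (b ∷ bs) K = begin
    Σ (allAssign (suc n) (b ∷ bs)) (λ f → K (map count₀ f) (map strip₀ f))
      ≈⟨ Σ-allAssign-∷ (suc n) b bs _ ⟩
    Σ (allVecs (suc n) b) (λ v → Σ (allAssign (suc n) bs)
        (λ g → K (count₀ v ∷ map count₀ g) (strip₀ v ∷ map strip₀ g)))
      ≈⟨ Σ-cong (allVecs (suc n) b) (λ v →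
           Σ-allAssign-split n bs (λ α g → K (count₀ v ∷ α) (strip₀ v ∷ g))) ⟩
    Σ (allVecs (suc n) b) (λ v → H (count₀ v) (strip₀ v))
      ≈⟨ Σ-allVecs-split n b H ⟩
    Σbinom b (λ a m → Σ (allVecs n m) (H a))
      ≈⟨ Σ<-cong (suc b) (λ a _ → scale-inside a) ⟩
    Σ< (suc b) (λ a → Σ (boxVecs bs) (summand a))
      ≡⟨ Σ-applyUpTo id (suc b) (λ a → Σ (boxVecs bs) (summand a)) ⟨
    Σ (upTo (suc b)) (λ a → Σ (boxVecs bs) (summand a))
      ≈⟨ Σ-concatMap-∷ (upTo (suc b)) (boxVecs bs) _ ⟨
    Σ (boxVecs (b ∷ bs)) (λ α → natR R (binomVec (b ∷ bs) α) *
      Σ (allAssign n (zipWith _∸_ (b ∷ bs) α)) (K α)) ∎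
    where
    C-bs : List ℕ → Carrier
    C-bs α = natR R (binomVec bs α)
    rest : ℕ → List ℕ → List (Fin n) → Carrier
    rest a α w = Σ (allAssign n (zipWith _∸_ bs α)) (λ g → K (a ∷ α) (w ∷ g))
    H : ℕ → List (Fin n) → Carrier
    H a w = Σ (boxVecs bs) (λ α → C-bs α * rest a α w)
    summand : ℕ → List ℕ → Carrier
    summand a α = natR R ((b C a) ℕ.* binomVec bs α) *
                  Σ (allAssign n ((b ∸ a) ∷ zipWith _∸_ bs α)) (K (a ∷ α))
    scale-inside : ∀ a → natR R (b C a) * Σ (allVecs n (b ∸ a)) (H a) ≈ Σ (boxVecs bs) (summand a)
    scale-inside a = begin
      natR R (b C a) * Σ (allVecs n (b ∸ a)) (H a)
        ≈⟨ *-congˡ (Σ-comm (allVecs n (b ∸ a)) (boxVecs bs) _) ⟩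
      natR R (b C a) * Σ (boxVecs bs) (λ α → Σ (allVecs n (b ∸ a)) (λ w → C-bs α * rest a α w))
        ≈⟨ *-distribˡ-Σ _ (boxVecs bs) _ ⟩
      Σ (boxVecs bs) (λ α → natR R (b C a) * Σ (allVecs n (b ∸ a)) (λ w → C-bs α * rest a α w))
        ≈⟨ Σ-cong (boxVecs bs) (λ α → begin
             natR R (b C a) * Σ (allVecs n (b ∸ a)) (λ w → C-bs α * rest a α w)
               ≈⟨ *-congˡ (*-distribˡ-Σ _ (allVecs n (b ∸ a)) (rest a α)) ⟨
             natR R (b C a) * (C-bs α * Σ (allVecs n (b ∸ a)) (rest a α))
               ≈⟨ *-assoc _ _ _ ⟨
             natR R (b C a) * C-bs α * Σ (allVecs n (b ∸ a)) (rest a α)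
               ≈⟨ *-cong (natR-* (b C a) (binomVec bs α))
                         (Σ-allAssign-∷ n (b ∸ a) (zipWith _∸_ bs α) (K (a ∷ α))) ⟨
             summand a α ∎) ⟩
      Σ (boxVecs bs) (summand a) ∎

  BlockSymmetric : ∀ {n} → (List (List (Fin n)) → Carrier) → Set ℓ
  BlockSymmetric F = ∀ {f f′} → f ↭ f′ → F f ≈ F f′

  Σ-allAssign-cong-↭ : ∀ n {l l′} (F : List (List (Fin n)) → Carrier) →
    BlockSymmetric F → l ↭ l′ → Σ (allAssign n l) F ≈ Σ (allAssign n l′) F
  Σ-allAssign-cong-↭ n F symF ↭.refl = refl
  Σ-allAssign-cong-↭ n F symF (↭.prep {bs} {bs′} b p) = begin
    Σ (allAssign n (b ∷ bs)) F
      ≈⟨ Σ-allAssign-∷ n b bs F ⟩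
    Σ (allVecs n b) (λ v → Σ (allAssign n bs) (λ g → F (v ∷ g)))
      ≈⟨ Σ-cong (allVecs n b) (λ v → Σ-allAssign-cong-↭ n (λ g → F (v ∷ g)) (symF ∘ ↭.prep v) p) ⟩
    Σ (allVecs n b) (λ v → Σ (allAssign n bs′) (λ g → F (v ∷ g)))
      ≈⟨ Σ-allAssign-∷ n b bs′ F ⟨
    Σ (allAssign n (b ∷ bs′)) F ∎
  Σ-allAssign-cong-↭ n F symF (↭.swap {bs} {bs′} a b p) = begin
    Σ (allAssign n (a ∷ b ∷ bs)) F
      ≈⟨ Σ-allAssign-∷ n a (b ∷ bs) F ⟩
    Σ (allVecs n a) (λ v → Σ (allAssign n (b ∷ bs)) (λ g → F (v ∷ g)))
      ≈⟨ Σ-cong (allVecs n a) (λ v → Σ-allAssign-∷ n b bs (λ g → F (v ∷ g))) ⟩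
    Σ (allVecs n a) (λ v → Σ (allVecs n b) (λ w → Σ (allAssign n bs) (λ g → F (v ∷ w ∷ g))))
      ≈⟨ Σ-cong (allVecs n a) (λ v → Σ-cong (allVecs n b) (λ w →
           trans (Σ-allAssign-cong-↭ n (λ g → F (v ∷ w ∷ g)) (symF ∘ ↭.prep v ∘ ↭.prep w) p)
                 (Σ-cong (allAssign n bs′) (λ g → symF (↭.swap v w ↭.refl))))) ⟩
    Σ (allVecs n a) (λ v → Σ (allVecs n b) (λ w → Σ (allAssign n bs′) (λ g → F (w ∷ v ∷ g))))
      ≈⟨ Σ-comm (allVecs n a) (allVecs n b) _ ⟩
    Σ (allVecs n b) (λ w → Σ (allVecs n a) (λ v → Σ (allAssign n bs′) (λ g → F (w ∷ v ∷ g))))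
      ≈⟨ Σ-cong (allVecs n b) (λ w → Σ-allAssign-∷ n a bs′ (λ g → F (w ∷ g))) ⟨
    Σ (allVecs n b) (λ w → Σ (allAssign n (a ∷ bs′)) (λ g → F (w ∷ g)))
      ≈⟨ Σ-allAssign-∷ n b (a ∷ bs′) F ⟨
    Σ (allAssign n (b ∷ a ∷ bs′)) F ∎
  Σ-allAssign-cong-↭ n F symF (↭.trans p q) =
    trans (Σ-allAssign-cong-↭ n F symF p) (Σ-allAssign-cong-↭ n F symF q)

  Σ-allAssign-filter : ∀ n (F : List (List (Fin n)) → Carrier) → BlockSymmetric F →
    (∀ f → F ([] ∷ f) ≈ F f) → ∀ l → Σ (allAssign n (filter positive? l)) F ≈ Σ (allAssign n l) F
  Σ-allAssign-filter n F symF F[]≈F [] = refl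
  Σ-allAssign-filter n F symF F[]≈F (zero ∷ l) = begin
    Σ (allAssign n (filter positive? l)) F ≈⟨ Σ-allAssign-filter n F symF F[]≈F l ⟩
    Σ (allAssign n l) F                    ≈⟨ Σ-cong (allAssign n l) F[]≈F ⟨
    Σ (allAssign n l) (λ g → F ([] ∷ g))   ≈⟨ +-identityʳ _ ⟨
    Σ (allVecs n 0) (λ v → Σ (allAssign n l) (λ g → F (v ∷ g)))
                                           ≈⟨ Σ-allAssign-∷ n 0 l F ⟨
    Σ (allAssign n (zero ∷ l)) F           ∎
  Σ-allAssign-filter n F symF F[]≈F (suc b ∷ l) = begin
    Σ (allAssign n (suc b ∷ filter positive? l)) F
      ≈⟨ Σ-allAssign-∷ n (suc b) (filter positive? l) F ⟩
    Σ (allVecs n (suc b)) (λ v → Σ (allAssign n (filter positive? l)) (λ g → F (v ∷ g)))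
      ≈⟨ Σ-cong (allVecs n (suc b)) (λ v →
           Σ-allAssign-filter n (λ g → F (v ∷ g)) (symF ∘ ↭.prep v) (F[]≈F-after v) l) ⟩
    Σ (allVecs n (suc b)) (λ v → Σ (allAssign n l) (λ g → F (v ∷ g)))
      ≈⟨ Σ-allAssign-∷ n (suc b) l F ⟨
    Σ (allAssign n (suc b ∷ l)) F ∎
    where
    F[]≈F-after : ∀ v f → F (v ∷ [] ∷ f) ≈ F (v ∷ f)
    F[]≈F-after v f = trans (symF (↭.swap v [] ↭.refl)) (F[]≈F (v ∷ f))

  Σ-allAssign-norm : ∀ n (F : List (List (Fin n)) → Carrier) → BlockSymmetric F →
    (∀ f → F ([] ∷ f) ≈ F f) → ∀ l → Σ (allAssign n (norm l)) F ≈ Σ (allAssign n l) F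
  Σ-allAssign-norm n F symF F[]≈F l =
    trans (Σ-allAssign-cong-↭ n F symF (norm-↭ l)) (Σ-allAssign-filter n F symF F[]≈F l)

  Π-lookup-∷ : ∀ {n} x (y : Vec Carrier n) v →
    Π v (Vec.lookup (x ∷ y)) ≈ powR R x (count₀ v) * Π (strip₀ v) (Vec.lookup y)
  Π-lookup-∷ x y []               = sym (*-identityˡ _)
  Π-lookup-∷ x y (Fin.zero  ∷ v) = trans (*-congˡ (Π-lookup-∷ x y v)) (sym (*-assoc _ _ _))
  Π-lookup-∷ x y (Fin.suc i ∷ v) = trans (*-congˡ (Π-lookup-∷ x y v)) (x*[y*z]≈y*[x*z] _ _ _)

  monomial-split : ∀ {n} x (y : Vec Carrier n) f →
    monomial R (x ∷ y) f ≈ powR R x (sum (map count₀ f)) * monomial R y (map strip₀ f)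
  monomial-split x y []      = sym (*-identityˡ _)
  monomial-split x y (v ∷ f) = begin
    Π (v ++ concat f) (Vec.lookup (x ∷ y))
      ≈⟨ Π-++ v (concat f) _ ⟩
    Π v (Vec.lookup (x ∷ y)) * monomial R (x ∷ y) f
      ≈⟨ *-cong (Π-lookup-∷ x y v) (monomial-split x y f) ⟩
    (powR R x (count₀ v) * Π (strip₀ v) (Vec.lookup y)) *
      (powR R x (sum (map count₀ f)) * monomial R y (map strip₀ f))
      ≈⟨ *-interchange _ _ _ _ ⟩
    (powR R x (count₀ v) * powR R x (sum (map count₀ f))) *
      (Π (strip₀ v) (Vec.lookup y) * monomial R y (map strip₀ f))
      ≈⟨ *-cong (powR-+ x (count₀ v) _) (Π-++ (strip₀ v) (concat (map strip₀ f)) _) ⟨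
    powR R x (sum (map count₀ (v ∷ f))) * monomial R y (map strip₀ (v ∷ f)) ∎

  monomial-cong-↭ : ∀ {n} (y : Vec Carrier n) {f f′} → f ↭ f′ → monomial R y f ≈ monomial R y f′
  monomial-cong-↭ y {f} {f′} p = begin
    monomial R y f                  ≈⟨ Π-concat f (Vec.lookup y) ⟩
    Π f (λ v → Π v (Vec.lookup y))  ≈⟨ Π-cong-↭ (λ v → Π v (Vec.lookup y)) p ⟩
    Π f′ (λ v → Π v (Vec.lookup y)) ≈⟨ Π-concat f′ (Vec.lookup y) ⟨
    monomial R y f′                 ∎

  module _ (G : List ℕ → Carrier) where

    term : ∀ {n} → Vec Carrier n → List (List (Fin n)) → Carrier
    term y f = weight R G f * monomial R y f

    weight-cong-↭ : ∀ {n} {f f′ : List (List (Fin n))} → f ↭ f′ → weight R G f ≡ weight R G f′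
    weight-cong-↭ {n} p = ≡.cong (prodR R)
      (ListP.map-cong (λ k → ≡.cong G (norm-cong-↭ (↭P.map⁺ (count k) p))) (allFin n))

    weight-split : ∀ {n} (f : List (List (Fin (suc n)))) →
      weight R G f ≡ G (norm (map count₀ f)) * weight R G (map strip₀ f)
    weight-split {n} f = ≡.cong (prodR R) (≡.trans (map-allFin-suc (G ∘ fiberType f))
      (≡.cong (G (fiberType f Fin.zero) ∷_)
              (ListP.map-cong (≡.cong G ∘ fiberType-suc f) (allFin n))))

    term-split : ∀ {n} x (y : Vec Carrier n) f →
      term (x ∷ y) f ≈
      (powR R x (sum (map count₀ f)) * G (norm (map count₀ f))) * term y (map strip₀ f)
    term-split x y f = begin
      weight R G f * monomial R (x ∷ y) f
        ≈⟨ *-cong (reflexive (weight-split f)) (monomial-split x y f) ⟩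
      (G (norm (map count₀ f)) * weight R G (map strip₀ f)) *
        (powR R x (sum (map count₀ f)) * monomial R y (map strip₀ f))
        ≈⟨ *-interchange _ _ _ _ ⟩
      (G (norm (map count₀ f)) * powR R x (sum (map count₀ f))) * term y (map strip₀ f)
        ≈⟨ *-congʳ (*-comm _ _) ⟩
      (powR R x (sum (map count₀ f)) * G (norm (map count₀ f))) * term y (map strip₀ f) ∎

    pEval-norm : ∀ {n} (y : Vec Carrier n) l → pEval R G (norm l) y ≈ pEval R G l y
    pEval-norm {n} y = Σ-allAssign-norm n (term y)
      (λ p → *-cong (reflexive (weight-cong-↭ p)) (monomial-cong-↭ y p)) (λ _ → refl)

    Σ-scaled-term : ∀ {n} k (y : Vec Carrier n) l →
      Σ (allAssign n l) (λ g → k * term y g) ≈ k * pEval R G (norm l) y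
    Σ-scaled-term {n} k y l =
      trans (sym (*-distribˡ-Σ k (allAssign n l) (term y))) (*-congˡ (sym (pEval-norm y l)))

corollary7 : {c ℓ : Level} (R : CommutativeRing c ℓ)
    (G : List ℕ → CommutativeRing.Carrier R) →
    QuasiGenus R G → Full R G →
    (la : List ℕ) → IsPartition la →
    (n : ℕ) (x : CommutativeRing.Carrier R) (y : Vec (CommutativeRing.Carrier R) n) →
    CommutativeRing._≈_ R (pEval R G la (x ∷ y)) (rhs R G la x y)
corollary7 R G _ _ la _ n x y = begin
  pEval R G la (x ∷ y)
    ≈⟨ Σ-cong (allAssign (suc n) la) (term-split G x y) ⟩
  Σ (allAssign (suc n) la) (λ f → K (map count₀ f) (map strip₀ f))
    ≈⟨ Σ-allAssign-split n la K ⟩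
  Σ (boxVecs la) (λ α → natR R (binomVec la α) * Σ (allAssign n (zipWith _∸_ la α)) (K α))
    ≈⟨ Σ-cong (boxVecs la) (λ α →
         trans (*-congˡ (Σ-scaled-term G _ y (zipWith _∸_ la α)))
               (sym (trans (*-congʳ (*-assoc _ _ _)) (*-assoc _ _ _)))) ⟩
  rhs R G la x y ∎
  where
  open CommutativeRing R hiding (zero)
  open BigOperators R
  open Assignments R
  open import Relation.Binary.Reasoning.Setoid setoid

  K : List ℕ → List (List (Fin n)) → Carrier
  K α g = (powR R x (sum α) * G (norm α)) * term G y g
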